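{- For any fixed ordinal $\alpha$, there exists a family of structures that is $\mathbf{nUs}$-learnable but not $\alpha$-learnable.
   Context: All structures are countable, have domain $\mathbb{N}$, finite relational signature, identified with atomic diagrams in $2^{\mathbb{N}}$; $\mathcal{S}\restriction_s$ is the finite substructure on $\{0,\dots,s\}$. A family $\mathfrak{K}$ is a countable set of pairwise nonisomorphic countable structures; $\mathrm{LD}(\mathfrak{K})$ = structures isomorphic to a member of $\mathfrak{K}$; $\mathrm{HS}(\mathfrak{K})=\{\ulcorner\mathcal{A}\urcorner:\mathcal{A}\in\mathfrak{K}\}\cup\{?\}$. A learner is an arbitrary function $\mathbf{M}$ from $\{\mathcal{S}\restriction_s:\mathcal{S}\in\mathrm{LD}(\mathfrak{K})\}$ (including the empty initial segment) to $\mathrm{HS}(\mathfrak{K})$. $\mathbf{M}$ $\mathbf{Ex}$-learns $\mathfrak{K}$ if for all $\mathcal{S}\in\mathrm{LD}(\mathfrak{K})$, $\mathcal{A}\in\mathfrak{K}$: $\lim_n\mathbf{M}(\mathcal{S}\restriction_n)=\ulcorner\mathcal{A}\urcorner$ iff $\mathcal{S}\cong\mathcal{A}$. $\mathbf{M}$ $\mathbf{nUs}$-learns $\mathfrak{K}$ if it $\mathbf{Ex}$-learns $\mathfrak{K}$ and, whenever $\mathcal{S}\cong\mathcal{A}$, after the first stage at which $\mathbf{M}$ outputs $\ulcorner\mathcal{A}\urcorner$ it outputs $\ulcorner\mathcal{A}\urcorner$ forever. A mind change counter for $\mathbf{M}$ is a function $c$ from the finite initial segments $\mathcal{S}\restriction_s$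 to ordinals such that $c(\mathcal{S}\restriction_{s+1})\le c(\mathcal{S}\restriction_s)$, with strict inequality iff $\mathbf{M}$ changes its mind at $\mathcal{S}\restriction_{s+1}$ (i.e., $\mathbf{M}(\mathcal{S}\restriction_s)\neq ?$ and $\mathbf{M}(\mathcal{S}\restriction_{s+1})\neq\mathbf{M}(\mathcal{S}\restriction_s)$). $\mathfrak{K}$ is $\alpha$-learnable if some learner $\mathbf{M}$ $\mathbf{Ex}$-learns $\mathfrak{K}$ and has a mind change counter $c$ with $c(\langle\rangle)=\alpha$ on the empty initial segment. -}

module Defs where

open import Level using (Level; 0ℓ) renaming (suc to lsuc)
open import Data.Nat using (ℕ; zero; suc; _<_; _≤_)
open import Data.Fin using (Fin)
open import Data.Vec using (Vec)
import Data.Vec as Vec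
open import Data.Vec.Relation.Unary.All using (All)
open import Data.Bool using (Bool)
open import Data.Maybe using (Maybe; just; nothing)
open import Data.Product using (Σ; ∃; _×_; _,_)
open import Data.Sum using (_⊎_)
open import Function using (Injective)
open import Function.Bundles using (_↔_; Inverse)
open import Relation.Binary.PropositionalEquality using (_≡_; _≢_)
open import Relation.Binary.Definitions using (Transitive; Trichotomous)
open import Induction.WellFounded using (WellFounded)
open import Relation.Nullary using (¬_)

-- Ordinals: an ordinal is presented as an element of a well-order
-- (a strict, transitive, trichotomous, well-founded relation).

record WellOrder : Set₁ where
  field
    Carrier : Set
    _≺_     : Carrier → Carrier → Set
    trans   : Transitive _≺_
    tri     : Trichotomous _≡_ _≺_
    wf      : WellFounded _≺_

  _≼_ : Carrier → Carrier → Set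
  a ≼ b = (a ≺ b) ⊎ (a ≡ b)

record Signature : Set where
  field
    nRel  : ℕ
    arity : Fin nRel → ℕ
open Signature public

Structure : Signature → Set
Structure σ = (r : Fin (nRel σ)) → Vec ℕ (arity σ r) → Bool

_≅_ : {σ : Signature} → Structure σ → Structure σ → Set
_≅_ {σ} S T = Σ (ℕ ↔ ℕ) λ f →
  ∀ (r : Fin (nRel σ)) (xs : Vec ℕ (arity σ r)) →
    S r xs ≡ T r (Vec.map (Inverse.to f) xs)

-- S and T have the same restriction to {0,…,n-1}
-- (n = 0 : the empty initial segment; n = s+1 : the paper's S↾s).
AgreeBelow : {σ : Signature} → ℕ → Structure σ → Structure σ → Set
AgreeBelow {σ} n S T = ∀ (r : Fin (nRel σ)) (xs : Vec ℕ (arity σ r)) →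
  All (_< n) xs → S r xs ≡ T r xs

record Family (σ : Signature) : Set₁ where
  field
    Idx      : Set
    code     : Idx → ℕ
    code-inj : Injective _≡_ _≡_ code
    str      : Idx → Structure σ
    noniso   : ∀ i j → str i ≅ str j → i ≡ j

module _ {σ : Signature} (K : Family σ) where
  open Family K

  InLD : Structure σ → Set
  InLD S = Σ Idx λ i → S ≅ str i

  -- HS(K): just i = ⌜str i⌝, nothing = ?
  Hyp : Set
  Hyp = Maybe Idx

  -- A function on finite initial segments S↾n of structures in LD(K)
  -- (n = 0 being the empty segment): it may only depend on S↾n.
  record SegmentFun (B : Set) : Set where
    field
      run   : (S : Structure σ) → InLD S → ℕ → B
      local : ∀ n S T (p : InLD S) (q : InLD T) → AgreeBelow n S T →
              run S p n ≡ run T q n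
  open SegmentFun public

  Learner : Set
  Learner = SegmentFun Hyp

  ConvergesTo : (Learner) → (S : Structure σ) → InLD S → Idx → Set
  ConvergesTo M S p i = ∃ λ N → ∀ n → N ≤ n → run M S p n ≡ just i

  ExLearns : Learner → Set
  ExLearns M = ∀ S (p : InLD S) (i : Idx) →
    (ConvergesTo M S p i → S ≅ str i) × (S ≅ str i → ConvergesTo M S p i)

  nUsLearns : Learner → Set
  nUsLearns M = ExLearns M ×
    (∀ S (p : InLD S) (i : Idx) → S ≅ str i →
       ∀ n → run M S p n ≡ just i → ∀ m → n ≤ m → run M S p m ≡ just i)

  nUsLearnable : Set
  nUsLearnable = Σ Learner nUsLearns

  -- M changes its mind at S↾(n+1) (segment index n+1 in our indexing)
  MindChange : Learner → (S : Structure σ) → InLD S → ℕ → Set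
  MindChange M S p n = (run M S p n ≢ nothing) × (run M S p (suc n) ≢ run M S p n)

  module _ (O : WellOrder) where
    open WellOrder O

    IsMindChangeCounter : Learner → SegmentFun Carrier → Set
    IsMindChangeCounter M c = ∀ S (p : InLD S) n →
      (run c S p (suc n) ≼ run c S p n) ×
      ((run c S p (suc n) ≺ run c S p n → MindChange M S p n) ×
       (MindChange M S p n → run c S p (suc n) ≺ run c S p n))

    Learnable : Carrier → Set
    Learnable α = Σ Learner λ M → ExLearns M × Σ (SegmentFun Carrier) λ c →
      IsMindChangeCounter M c × (∀ S (p : InLD S) → run c S p 0 ≡ α)

-- The family consists of the structures with one unary predicate that holds
-- on exactly k points, for k ∈ ℕ. Counting the predicate points seen so far
-- learns it without U-shapes: the count only grows, never overshoots k, and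
-- eventually reaches k. No learner has an ordinal mind change counter: an
-- adversary feeds a finite structure until the learner settles on its size k,
-- then adds a fresh point far out. The learner must later switch to k + 1,
-- the counter strictly drops, and repeating this forever contradicts
-- well-foundedness.
module Submission where

open import Defs
open import Data.Bool using (Bool; true; false; _∨_)
open import Data.Bool.Properties using (∨-zeroʳ; ∨-identityʳ)
open import Data.Empty using (⊥; ⊥-elim)
import Data.Fin as Fin
open import Data.Maybe using (Maybe; just; nothing)
open import Data.Maybe.Properties using (just-injective; ≡-dec)
open import Data.Nat
  using (ℕ; zero; suc; _+_; _≤_; _<_; _≤′_; ≤′-refl; ≤′-step; _<?_; _≟_; _⊔_; s≤s)
open import Data.Nat.Properties
open import Algebra.Properties.CommutativeSemigroup +-commutativeSemigroup using (interchange)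
open import Data.Product using (Σ; ∃; _×_; _,_; proj₁; proj₂)
open import Data.Sum using (inj₂)
open import Data.Vec using ([]; _∷_)
open import Data.Vec.Relation.Unary.All using ([]; _∷_)
open import Function using (_∘_; id)
open import Function.Bundles using (_↔_; Inverse; mk↔ₛ′; _⇔_; mk⇔)
open import Function.Properties.Inverse using (↔-refl; ↔-trans)
open import Induction.WellFounded using (Acc; acc)
open import Relation.Binary.Definitions using (DecidableEquality; tri<; tri≈; tri>)
open import Relation.Binary.PropositionalEquality
open import Relation.Nullary using (¬_; yes; no; does)
open import Relation.Nullary.Decidable using (dec-true; dec-false; does-⇔)
import Relation.Binary.Construct.StrictToNonStrict as StrictToNonStrict

private
  variable
    a b c k m n t : ℕ
    Q R U : ℕ → Bool

Eventually : (ℕ → Set) → Set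
Eventually P = ∃ λ N → ∀ n → N ≤ n → P n

eventually-map : {P P′ : ℕ → Set} → (∀ n → P n → P′ n) → Eventually P → Eventually P′
eventually-map f (N , h) = N , λ n N≤n → f n (h n N≤n)

eventually-zip : {P P′ : ℕ → Set} → Eventually P → Eventually P′ →
  Eventually (λ n → P n × P′ n)
eventually-zip (N , h) (N′ , h′) =
  N ⊔ N′ , λ n le → h n (≤-trans (m≤m⊔n N N′) le) , h′ n (≤-trans (m≤n⊔m N N′) le)

eventually-≡-unique : {A : Set} {f : ℕ → A} {x y : A} →
  Eventually (λ n → f n ≡ x) → Eventually (λ n → f n ≡ y) → x ≡ y
eventually-≡-unique fx fy with eventually-zip fx fy
... | N , h = let fN≡x , fN≡y = h N ≤-refl in trans (sym fN≡x) fN≡y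

indicator : Bool → ℕ
indicator false = 0
indicator true  = 1

count : (ℕ → Bool) → ℕ → ℕ
count Q zero    = 0
count Q (suc n) = count Q n + indicator (Q n)

count-cong : ∀ n → (∀ x → x < n → Q x ≡ R x) → count Q n ≡ count R n
count-cong zero    eq = refl
count-cong (suc n) eq =
  cong₂ _+_ (count-cong n λ x x<n → eq x (m<n⇒m<1+n x<n)) (cong indicator (eq n ≤-refl))

count-mono′ : m ≤′ n → count Q m ≤ count Q n
count-mono′ ≤′-refl       = ≤-refl
count-mono′ (≤′-step m≤n) = ≤-trans (count-mono′ m≤n) (m≤m+n _ _)

count-mono : m ≤ n → count Q m ≤ count Q n
count-mono = count-mono′ ∘ ≤⇒≤′

count-additive : (∀ x → indicator (Q x) ≡ indicator (R x) + indicator (U x)) →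
  ∀ n → count Q n ≡ count R n + count U n
count-additive         split zero    = refl
count-additive {Q} {R} {U} split (suc n) = begin
  count Q n + indicator (Q n)
    ≡⟨ cong₂ _+_ (count-additive split n) (split n) ⟩
  (count R n + count U n) + (indicator (R n) + indicator (U n))
    ≡⟨ interchange (count R n) _ _ _ ⟩
  count R (suc n) + count U (suc n)
    ∎
  where open ≡-Reasoning

count-none : ∀ n → (∀ x → x < n → Q x ≡ false) → count Q n ≡ 0
count-none zero    none = refl
count-none (suc n) none
  rewrite count-none n (λ x x<n → none x (m<n⇒m<1+n x<n)) | none n ≤-refl = refl

singleton : ℕ → ℕ → Bool
singleton c x = does (x ≟ c)

count-singleton : c < n → count (singleton c) n ≡ 1
count-singleton {c} {suc n} c<1+n with n ≟ c
... | yes refl = cong₂ _+_ (count-none n λ x x<n → dec-false (x ≟ n) (<⇒≢ x<n))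
                          (cong indicator (dec-true (n ≟ n) refl))
... | no n≢c   = cong₂ _+_ (count-singleton (≤∧≢⇒< (m<1+n⇒m≤n c<1+n) (n≢c ∘ sym)))
                          (cong indicator (dec-false (n ≟ c) n≢c))

module _ (f : ℕ ↔ ℕ) where
  open Inverse f

  below : ℕ → ℕ → Bool
  below j x = does (to x <? j)

  below-suc : ∀ j x →
    indicator (below (suc j) x) ≡ indicator (below j x) + indicator (singleton (from j) x)
  below-suc j x with <-cmp (to x) j
  ... | tri< fx<j fx≢j _
    rewrite dec-true (to x <? suc j) (m<n⇒m<1+n fx<j) | dec-true (to x <? j) fx<j
          | dec-false (x ≟ from j) (fx≢j ∘ inverseˡ) = refl
  ... | tri≈ fx≮j fx≡j _
    rewrite dec-true (to x <? suc j) (s≤s (≤-reflexive fx≡j)) | dec-false (to x <? j) fx≮j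
          | dec-true (x ≟ from j) (sym (inverseʳ (sym fx≡j))) = refl
  ... | tri> _ fx≢j j<fx
    rewrite dec-false (to x <? suc j) (<⇒≱ j<fx ∘ m<1+n⇒m≤n) | dec-false (to x <? j) (<⇒≯ j<fx)
          | dec-false (x ≟ from j) (fx≢j ∘ inverseˡ) = refl

  count-below : ∀ j → Eventually (λ n → count (below j) n ≡ j)
  count-below zero    = 0 , λ n _ → count-none n λ x _ → dec-false (to x <? 0) λ ()
  count-below (suc j) = eventually-map step
    (eventually-zip (count-below j) (suc (from j) , λ n le → count-singleton le))
    where
    step : ∀ n → count (below j) n ≡ j × count (singleton (from j)) n ≡ 1 →
           count (below (suc j)) n ≡ suc j
    step n (below≡j , singleton≡1) = begin
      count (below (suc j)) n                          ≡⟨ count-additive (below-suc j) n ⟩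
      count (below j) n + count (singleton (from j)) n ≡⟨ cong₂ _+_ below≡j singleton≡1 ⟩
      j + 1                                            ≡⟨ +-comm j 1 ⟩
      suc j                                            ∎
      where open ≡-Reasoning

swap : ℕ → ℕ → ℕ → ℕ
swap b k x with x ≟ b | x ≟ k
... | yes _ | _     = k
... | no _  | yes _ = b
... | no _  | no _  = x

swap-involutive : ∀ b k x → swap b k (swap b k x) ≡ x
swap-involutive b k x with x ≟ b | x ≟ k
swap-involutive b k x | yes refl | _ with k ≟ x | k ≟ k
... | yes k≡x | _      = k≡x
... | no _    | yes _  = refl
... | no _    | no k≢k = ⊥-elim (k≢k refl)
swap-involutive b k x | no _ | yes refl with b ≟ b
... | yes _  = refl
... | no b≢b = ⊥-elim (b≢b refl)
swap-involutive b k x | no x≢b | no x≢k with x ≟ b | x ≟ k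
... | yes x≡b | _       = ⊥-elim (x≢b x≡b)
... | no _    | yes x≡k = ⊥-elim (x≢k x≡k)
... | no _    | no _    = refl

swap-↔ : ℕ → ℕ → ℕ ↔ ℕ
swap-↔ b k = mk↔ₛ′ (swap b k) (swap b k) (swap-involutive b k) (swap-involutive b k)

Unary : Signature
Unary = record { nRel = 1 ; arity = λ _ → 1 }

holds : Structure Unary → ℕ → Bool
holds S x = S Fin.zero (x ∷ [])

unary : (ℕ → Bool) → Structure Unary
unary Q _ (x ∷ []) = Q x

segment : ℕ → Structure Unary
segment k = unary (λ x → does (x <? k))

insert : ℕ → Structure Unary → Structure Unary
insert a S = unary (λ x → holds S x ∨ singleton a x)

private
  variable
    S T V : Structure Unary

-- For one unary predicate an isomorphism is a bijection preserving it. Unlike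
-- the Σ-type _≅_, this record lets Agda infer both structures from its type.
record _≃_ (S T : Structure Unary) : Set where
  constructor mk≃
  field
    bijection : ℕ ↔ ℕ
    preserves : ∀ x → holds S x ≡ holds T (Inverse.to bijection x)

≅⇒≃ : ∀ T → S ≅ T → S ≃ T
≅⇒≃ _ (f , h) = mk≃ f λ x → h Fin.zero (x ∷ [])

≃⇒≅ : S ≃ T → S ≅ T
≃⇒≅ (mk≃ f h) = f , λ { Fin.zero (x ∷ []) → h x }

≃-refl : S ≃ S
≃-refl = mk≃ ↔-refl λ _ → refl

≃-trans : S ≃ T → T ≃ V → S ≃ V
≃-trans (mk≃ f S≃T) (mk≃ g T≃V) = mk≃ (↔-trans f g) λ x → trans (S≃T x) (T≃V (Inverse.to f x))

count-converges : S ≃ segment k → Eventually (λ n → count (holds S) n ≡ k)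
count-converges {k = k} (mk≃ f S≃k) =
  eventually-map (λ n → trans (count-cong n λ x _ → S≃k x)) (count-below f k)

count-bounded : S ≃ segment k → ∀ n → count (holds S) n ≤ k
count-bounded S≃k n with count-converges S≃k
... | N , h = subst (_ ≤_) (h (n ⊔ N) (m≤n⊔m n N)) (count-mono (m≤m⊔n n N))

segment-injective : segment a ≃ segment b → a ≡ b
segment-injective = eventually-≡-unique (count-converges ≃-refl) ∘ count-converges

insert-transport : ((mk≃ f _) : S ≃ T) → insert a S ≃ insert (Inverse.to f a) T
insert-transport {a = a} (mk≃ f S≃T) =
  mk≃ f λ x → cong₂ _∨_ (S≃T x) (does-⇔ (mk⇔ (cong to) injective) (x ≟ a) (to x ≟ to a))
  where
  open Inverse f
  injective : ∀ {x y} → to x ≡ to y → x ≡ y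
  injective {x} {y} eq = trans (sym (inverseʳ refl)) (trans (cong from eq) (inverseʳ refl))

-- The transposition of b and k moves the new point b into the slot k.
insert-segment : k ≤ b → insert b (segment k) ≃ segment (suc k)
insert-segment {k} {b} k≤b = mk≃ (swap-↔ b k) moved
  where
  moved : ∀ x → (does (x <? k) ∨ singleton b x) ≡ does (swap b k x <? suc k)
  moved x with x ≟ b | x ≟ k
  ... | yes x≡b | _      = trans (cong (does (x <? k) ∨_) (dec-true (x ≟ b) x≡b))
                               (trans (∨-zeroʳ _) (sym (dec-true (k <? suc k) (n<1+n k))))
  ... | no x≢b | yes refl =
    trans (cong₂ _∨_ (dec-false (x <? x) (<-irrefl refl)) (dec-false (x ≟ b) x≢b))
          (sym (dec-false (b <? suc x) λ b<1+x → x≢b (≤-antisym k≤b (m<1+n⇒m≤n b<1+x))))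
  ... | no x≢b | no x≢k  =
    trans (cong (does (x <? k) ∨_) (dec-false (x ≟ b) x≢b))
          (trans (∨-identityʳ _) (does-⇔ x<k⇔x<1+k (x <? k) (x <? suc k)))
    where
    x<k⇔x<1+k : (x < k) ⇔ (x < suc k)
    x<k⇔x<1+k = mk⇔ m<n⇒m<1+n λ x<1+k → ≤∧≢⇒< (m<1+n⇒m≤n x<1+k) x≢k

insert-≃ : S ≃ segment k → holds S a ≡ false → insert a S ≃ segment (suc k)
insert-≃ {S} {k} {a} S≃k@(mk≃ f preserves) fresh =
  ≃-trans (insert-transport S≃k) (insert-segment k≤fa)
  where
  k≤fa : k ≤ Inverse.to f a
  k≤fa = ≮⇒≥ λ fa<k →
    true≢false (trans (sym (dec-true (_ <? k) fa<k)) (trans (sym (preserves a)) fresh))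
    where
    true≢false : true ≢ false
    true≢false ()

insert-agrees : m ≤ a → AgreeBelow m (insert a S) S
insert-agrees {S = S} m≤a Fin.zero (x ∷ []) (x<m ∷ []) =
  trans (cong (holds S x ∨_) (dec-false (_ ≟ _) (<⇒≢ (<-≤-trans x<m m≤a)))) (∨-identityʳ _)

Segments : Family Unary
Segments = record
  { Idx = ℕ ; code = id ; code-inj = id ; str = segment
  ; noniso = λ _ j → segment-injective ∘ ≅⇒≃ (segment j) }

counting : Learner Segments
counting = record
  { run   = λ S _ n → just (count (holds S) n)
  ; local = λ n S T _ _ agree →
      cong just (count-cong n λ x x<n → agree Fin.zero (x ∷ []) (x<n ∷ [])) }

counting-ex : ExLearns Segments counting
counting-ex S (j , S≅j) i =
  converges⇒≅ , λ S≅i → eventually-map (λ _ → cong just) (count-converges (≅⇒≃ (segment i) S≅i))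
  where
  converges⇒≅ : ConvergesTo Segments counting S (j , S≅j) i → S ≅ segment i
  converges⇒≅ conv = subst (λ k → S ≅ segment k) j≡i S≅j
    where
    j≡i : j ≡ i
    j≡i = eventually-≡-unique (count-converges (≅⇒≃ (segment j) S≅j))
                              (eventually-map (λ _ → just-injective) conv)

counting-nUs : nUsLearns Segments counting
counting-nUs = counting-ex , λ S _ i S≅i n countₙ≡i m n≤m →
  cong just (≤-antisym (count-bounded (≅⇒≃ (segment i) S≅i) m)
                       (subst (_≤ count (holds S) m) (just-injective countₙ≡i) (count-mono n≤m)))

leaves : {A : Set} → DecidableEquality A → (h : ℕ → Maybe A) {x : A} →
  ∀ d → h a ≡ just x → h (d + a) ≢ just x →
  ∃ λ n → a ≤ n × h n ≡ just x × h (suc n) ≢ just x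
leaves _≟ᴬ_ h zero    ha≡x ha≢x = ⊥-elim (ha≢x ha≡x)
leaves {a} _≟ᴬ_ h {x} (suc d) ha≡x hd≢x with ≡-dec _≟ᴬ_ (h (suc a)) (just x)
... | no  h1+a≢x = a , ≤-refl , ha≡x , h1+a≢x
... | yes h1+a≡x with leaves _≟ᴬ_ h d h1+a≡x (hd≢x ∘ subst (λ z → h z ≡ just x) (+-suc d a))
...   | n , a<n , rest = n , <⇒≤ a<n , rest

EmptyFrom : Structure Unary → ℕ → Set
EmptyFrom S t = ∀ x → t ≤ x → holds S x ≡ false

module _ (O : WellOrder) (M : Learner Segments) (M-ex : ExLearns Segments M)
         (c : SegmentFun Segments (WellOrder.Carrier O))
         (c-counts : IsMindChangeCounter Segments O M c) where
  open WellOrder O using (_≺_; _≼_; wf) renaming (trans to ≺-trans)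
  open StrictToNonStrict _≡_ _≺_ using () renaming (trans to ≼-trans′; <-≤-trans to ≺-≼-trans′)

  ≼-trans : ∀ {u v w} → u ≼ v → v ≼ w → u ≼ w
  ≼-trans = ≼-trans′ isEquivalence (resp₂ _≺_) ≺-trans

  ≺-≼-trans : ∀ {u v w} → u ≺ v → v ≼ w → u ≺ w
  ≺-≼-trans = ≺-≼-trans′ ≺-trans (respʳ _≺_)

  counter-antitone : ∀ {S} (p : InLD Segments S) → m ≤′ n → run c S p n ≼ run c S p m
  counter-antitone p ≤′-refl       = inj₂ refl
  counter-antitone p (≤′-step m≤n) = ≼-trans (proj₁ (c-counts _ p _)) (counter-antitone p m≤n)

  counter-drops-after : ∀ {S} (p : InLD Segments S) {i} → m ≤ n →
    run M S p n ≡ just i → run M S p (suc n) ≢ just i → run c S p (suc n) ≺ run c S p m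
  counter-drops-after p {i} m≤n Mₙ≡i M₁₊ₙ≢i =
    ≺-≼-trans (proj₂ (proj₂ (c-counts _ p _)) mindChange) (counter-antitone p (≤⇒≤′ m≤n))
    where
    mindChange : MindChange Segments M _ p _
    mindChange = (λ Mₙ≡nothing → just≢nothing (trans (sym Mₙ≡i) Mₙ≡nothing))
               , λ eq → M₁₊ₙ≢i (trans eq Mₙ≡i)
      where
      just≢nothing : just i ≢ nothing
      just≢nothing ()

  record Extension (S : Structure Unary) (p : InLD Segments S) (t : ℕ) : Set where
    constructor mkExtension
    field
      {S′}   : Structure Unary
      p′     : InLD Segments S′
      t′     : ℕ
      empty′ : EmptyFrom S′ t′
      drops  : run c S′ p′ t′ ≺ run c S p t

  extend : ∀ {S} (p : InLD Segments S) → EmptyFrom S t → Extension S p t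
  extend {t} {S} p@(k , S≅k) empty = mkExtension p′ (suc s) empty′ drops
    where
    settled : ConvergesTo Segments M S p k
    settled = proj₂ (M-ex S p k) S≅k
    far : ℕ
    far = proj₁ settled ⊔ t
    t≤far : t ≤ far
    t≤far = m≤n⊔m _ t
    p′ : InLD Segments (insert far S)
    p′ = suc k , ≃⇒≅ (insert-≃ (≅⇒≃ (segment k) S≅k) (empty far t≤far))
    settled′ : ConvergesTo Segments M (insert far S) p′ (suc k)
    settled′ = proj₂ (M-ex (insert far S) p′ (suc k)) (proj₂ p′)
    before : run M (insert far S) p′ far ≡ just k
    before = trans (local M far _ S p′ p (insert-agrees ≤-refl)) (proj₂ settled far (m≤m⊔n _ t))
    after : run M (insert far S) p′ (proj₁ settled′ + far) ≢ just k
    after eq = 1+n≢n (just-injective (trans (sym (proj₂ settled′ _ (m≤m+n _ far))) eq))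
    change : ∃ λ s → far ≤ s × run M (insert far S) p′ s ≡ just k
                             × run M (insert far S) p′ (suc s) ≢ just k
    change = leaves _≟_ (run M (insert far S) p′) (proj₁ settled′) before after
    s : ℕ
    s = proj₁ change
    far≤s : far ≤ s
    far≤s = proj₁ (proj₂ change)
    empty′ : EmptyFrom (insert far S) (suc s)
    empty′ x s<x =
      trans (cong (_∨ singleton far x) (empty x (≤-trans t≤far (≤-trans far≤s (<⇒≤ s<x)))))
            (dec-false (x ≟ far) λ x≡far → <⇒≢ (≤-<-trans far≤s s<x) (sym x≡far))
    drops : run c (insert far S) p′ (suc s) ≺ run c S p t
    drops =
      let Mₛ≡k , M₁₊ₛ≢k = proj₂ (proj₂ change) in
      subst (run c (insert far S) p′ (suc s) ≺_) (local c t _ S p′ p (insert-agrees t≤far))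
            (counter-drops-after p′ (≤-trans t≤far far≤s) Mₛ≡k M₁₊ₛ≢k)

  no-descent : ∀ {S} (p : InLD Segments S) → EmptyFrom S t → Acc _≺_ (run c S p t) → ⊥
  no-descent p empty (acc smaller) = no-descent p′ empty′ (smaller drops)
    where open Extension (extend p empty)

  counter-impossible : ⊥
  counter-impossible =
    no-descent {t = 0} {S = segment 0} (0 , ≃⇒≅ ≃-refl) (λ x _ → dec-false (x <? 0) λ ()) (wf _)

segments-not-learnable : ∀ O α → ¬ Learnable Segments O α
segments-not-learnable O α (M , M-ex , c , c-counts , _) = counter-impossible O M M-ex c c-counts

mainTheorem13 : (O : WellOrder) (α : WellOrder.Carrier O) →
    Σ Signature λ σ → Σ (Family σ) λ K →
      nUsLearnable K × ¬ Learnable K O α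
mainTheorem13 O α = Unary , Segments , (counting , counting-nUs) , segments-not-learnable O α
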